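{- Let $L$ be a transitive permutation group and let $L_\omega$ be a point-stabiliser in $L$. Then $L$ is $f$-graph-restrictive, where $f(n) = |L_\omega|^{\frac{n-2}{2}}$. In particular, $L$ is $\mathrm{Exp}$-graph-restrictive.
   Context: All graphs are finite, simple and connected. For a graph $\Gamma$, a vertex $v$ and $G\le \mathrm{Aut}(\Gamma)$, $\Gamma(v)$ denotes the neighbourhood of $v$ and $G_v^{\Gamma(v)}$ the permutation group induced by the vertex-stabiliser $G_v$ on $\Gamma(v)$. $\Gamma$ is $G$-arc-transitive if $G\le\mathrm{Aut}(\Gamma)$ acts transitively on arcs (ordered pairs of adjacent vertices). A pair $(\Gamma,G)$ is locally-$L$ if $\Gamma$ is $G$-arc-transitive and $G_v^{\Gamma(v)}$ is permutation isomorphic to $L$. For a function $f:\mathbb N\to\mathbb R$, a transitive permutation group $L$ is $f$-graph-restrictive if for every locally-$L$ pair $(\Gamma,G)$ and every arc $(u,v)$ of $\Gamma$ we have $|G_{uv}|\le f(|\mathrm V(\Gamma)|)$. $\mathrm{Exp}$ is the class of functions $f(n)=\alpha^n$ with $\alpha>1$; $L$ is $\mathrm{Exp}$-graph-restrictive if it is $f$-graph-restrictive for some $f\in\mathrm{Exp}$. -}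

module Defs where

open import Data.Nat using (ℕ; zero; suc; _+_; _*_; _^_; _≤_; _<_)
open import Data.Fin using (Fin; _≟_)
open import Data.Vec using (Vec; lookup; tabulate)
open import Data.Bool using (Bool; true; false; _∧_)
open import Data.List using (List; []; _∷_; length; filterᵇ)
open import Data.List.Membership.Propositional using (_∈_)
open import Data.List.Relation.Unary.Unique.Propositional using (Unique)
open import Data.Product using (Σ; ∃; _×_; _,_)
open import Relation.Binary.PropositionalEquality using (_≡_)
open import Relation.Nullary.Decidable using (⌊_⌋)
open import Function.Definitions using (Injective)

-- Permutations of Fin n, stored as their value tables (g · i = lookup g i).

Perm : ℕ → Set
Perm n = Vec (Fin n) n

_·_ : ∀ {n} → Perm n → Fin n → Fin n
g · i = lookup g i

idPerm : ∀ {n} → Perm n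
idPerm = tabulate (λ i → i)

_∘ₚ_ : ∀ {n} → Perm n → Perm n → Perm n
g ∘ₚ h = tabulate (λ i → g · (h · i))

record PermGroup (n : ℕ) : Set where
  field
    elems      : List (Perm n)
    unique     : Unique elems
    bijective  : ∀ {g} → g ∈ elems → Injective _≡_ _≡_ (g ·_)
    has-id     : idPerm ∈ elems
    closed-∘   : ∀ {g h} → g ∈ elems → h ∈ elems → (g ∘ₚ h) ∈ elems
    closed-inv : ∀ {g} → g ∈ elems → Σ (Perm n) λ h → h ∈ elems × (g ∘ₚ h) ≡ idPerm
open PermGroup public

IsTransitive : ∀ {d} → PermGroup d → Set
IsTransitive {d} L = ∀ (i j : Fin d) → Σ (Perm d) λ l → l ∈ elems L × l · i ≡ j

stabOrder : ∀ {d} → PermGroup d → Fin d → ℕ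
stabOrder L ω = length (filterᵇ (λ l → ⌊ l · ω ≟ ω ⌋) (elems L))

stabOrder₂ : ∀ {n} → PermGroup n → Fin n → Fin n → ℕ
stabOrder₂ G u v = length (filterᵇ (λ g → ⌊ g · u ≟ u ⌋ ∧ ⌊ g · v ≟ v ⌋) (elems G))

data Reachable {n : ℕ} (adj : Fin n → Fin n → Bool) : Fin n → Fin n → Set where
  here : ∀ {u} → Reachable adj u u
  step : ∀ {u w v} → adj u w ≡ true → Reachable adj w v → Reachable adj u v

record Graph (n : ℕ) : Set where
  field
    adj       : Fin n → Fin n → Bool
    adj-sym   : ∀ u v → adj u v ≡ adj v u
    irrefl    : ∀ v → adj v v ≡ false
    connected : ∀ u v → Reachable adj u v
open Graph public

IsAutGroup : ∀ {n} → Graph n → PermGroup n → Set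
IsAutGroup Γ G = ∀ {g} → g ∈ elems G → ∀ u v → adj Γ (g · u) (g · v) ≡ adj Γ u v

IsArcTransitive : ∀ {n} → Graph n → PermGroup n → Set
IsArcTransitive {n} Γ G =
  ∀ u v u' v' → adj Γ u v ≡ true → adj Γ u' v' ≡ true →
  Σ (Perm n) λ g → g ∈ elems G × g · u ≡ u' × g · v ≡ v'

-- G_v^{Γ(v)} is permutation isomorphic to L: there is a bijection
-- β : Fin d → Γ(v) such that the permutation group induced by G_v on Γ(v)
-- is exactly β L β⁻¹.
LocalActionIso : ∀ {n d} → Graph n → PermGroup n → Fin n → PermGroup d → Set
LocalActionIso {n} {d} Γ G v L =
  Σ (Fin d → Fin n) λ β →
    Injective _≡_ _≡_ β
  × (∀ i → adj Γ v (β i) ≡ true)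
  × (∀ w → adj Γ v w ≡ true → Σ (Fin d) λ i → β i ≡ w)
  × (∀ {g} → g ∈ elems G → g · v ≡ v →
       Σ (Perm d) λ l → l ∈ elems L × (∀ i → g · β i ≡ β (l · i)))
  × (∀ {l} → l ∈ elems L →
       Σ (Perm n) λ g → g ∈ elems G × g · v ≡ v × (∀ i → g · β i ≡ β (l · i)))

IsLocally : ∀ {n d} → Graph n → PermGroup n → PermGroup d → Set
IsLocally Γ G L =
  IsAutGroup Γ G × IsArcTransitive Γ G × (∀ v → LocalActionIso Γ G v L)

-- L is "R-graph-restrictive", where R n s expresses the bound
-- "s ≤ f(n)" for s = |G_uv| and n = |V(Γ)|.
GraphRestrictive : ∀ {d} → PermGroup d → (ℕ → ℕ → Set) → Set
GraphRestrictive L R =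
  ∀ (n : ℕ) (Γ : Graph n) (G : PermGroup n) → IsLocally Γ G L →
  ∀ u v → adj Γ u v ≡ true → R n (stabOrder₂ G u v)

module Submission where

-- Grow a vertex set S, inducing no isolated vertex, along the connected graph: pick x ∈ S with a
-- neighbour outside S and add Γ(x). Restriction to Γ(x) maps the pointwise stabiliser G_S into a
-- conjugate of L_ω (G_S fixes a neighbour of x inside S), with fibres the cosets of
-- G_{S ∪ Γ(x)}; hence |G_S| ≤ |L_ω| |G_{S ∪ Γ(x)}|, and if Γ(x) brings a single new vertex then
-- G_S already fixes it. Either way each new vertex costs at most |L_ω|^(1/2), and G_{V(Γ)} = 1,
-- so |G_S|² |L_ω|^|S| ≤ |L_ω|^n. Starting from S = {u, v} gives the bound; α = |L_ω| + 2 then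
-- witnesses Exp-graph-restrictiveness.

open import Defs
open import Data.Nat using (ℕ; zero; suc; _+_; _*_; _^_; _∸_; _≤_; _<_; z≤n; s≤s; NonZero)
open import Data.Nat.Base using (>-nonZero)
open import Data.Nat.Properties
  using ( +-suc; +-mono-≤; +-monoˡ-≤; +-monoʳ-≤; *-monoˡ-≤; *-monoʳ-≤; *-comm
        ; *-identityˡ; *-identityʳ; *-cancelʳ-≤; ^-identityʳ; ^-zeroˡ; ^-distribˡ-+-*; ^-*-assoc
        ; ^-monoˡ-≤; ^-monoʳ-≤; m^n≢0; m≤m*n; m≤m+n; m≤n+m; m∸n≤m; m+[n∸m]≡n
        ; ≤-trans; ≤-reflexive; <⇒≱; module ≤-Reasoning )
open import Data.Nat.Solver using (module +-*-Solver)
open import Data.Bool using (Bool; true; T; _∧_)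
open import Data.Bool.Properties using (T-∧)
open import Data.Fin using (Fin; _≟_)
open import Data.Fin.Properties using (all?; ¬∀⟶∃¬)
open import Data.Vec using (Vec; lookup; tabulate)
open import Data.Vec.Properties using (≡-dec; lookup∘tabulate; tabulate∘lookup; tabulate-cong)
open import Data.List using (List; []; _∷_; _++_; length; map; filter)
import Data.List as List
open import Data.List.Properties using (length-map; length-++; length-tabulate; filter-≐)
open import Data.List.Membership.Propositional using (_∈_; _∉_)
open import Data.List.Membership.Propositional.Properties
  using ( ∈-∃++; ∈-++⁻; ∈-++⁺ˡ; ∈-++⁺ʳ; ∈-map⁺; ∈-map⁻; ∈-filter⁺; ∈-filter⁻
        ; ∈-tabulate⁺; ∈-tabulate⁻; ∈-allFin; ∈-length )
import Data.List.Membership.DecPropositional as DecMembership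
open import Data.List.Relation.Unary.Any using (here; there)
open import Data.List.Relation.Unary.All as All using (All; []; _∷_)
open import Data.List.Relation.Unary.Unique.Propositional using (Unique; []; _∷_)
import Data.List.Relation.Unary.Unique.Propositional.Properties as Unique
open import Data.List.Relation.Binary.Sublist.Propositional.Properties
  using (filter⁺; filter-⊆; length-mono-≤)
open import Data.Product using (Σ; ∃-syntax; _×_; _,_; proj₁; proj₂)
open import Data.Sum using (inj₁; inj₂)
open import Function using (id; case_of_; Equivalence)
open import Function.Definitions using (Injective)
open import Relation.Binary using (DecidableEquality)
open import Relation.Binary.PropositionalEquality
open import Relation.Nullary using (¬_; yes; no; ¬?; contradiction)
open import Relation.Nullary.Decidable using (⌊_⌋; toWitness; fromWitness)
open import Relation.Unary using (Pred; Decidable)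
open import Relation.Unary.Properties using (∁?)

module _ {A : Set} where

  Unique-⊆⇒length-≤ : ∀ {xs ys : List A} → Unique xs → (∀ {a} → a ∈ xs → a ∈ ys) →
                      length xs ≤ length ys
  Unique-⊆⇒length-≤ {[]}     _           _   = z≤n
  Unique-⊆⇒length-≤ {x ∷ xs} (x∉xs ∷ u) sub with ∈-∃++ (sub (here refl))
  ... | ys₁ , ys₂ , refl = subst (suc (length xs) ≤_) (sym length-hole)
          (s≤s (Unique-⊆⇒length-≤ u (λ a∈xs → drop-x (sub (there a∈xs)) (All.lookup x∉xs a∈xs))))
    where
    length-hole : length (ys₁ ++ x ∷ ys₂) ≡ suc (length (ys₁ ++ ys₂))
    length-hole rewrite length-++ ys₁ {x ∷ ys₂} | length-++ ys₁ {ys₂} = +-suc _ _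
    drop-x : ∀ {a} → a ∈ ys₁ ++ x ∷ ys₂ → ¬ x ≡ a → a ∈ ys₁ ++ ys₂
    drop-x a∈ x≢a with ∈-++⁻ ys₁ a∈
    ... | inj₁ a∈ys₁          = ∈-++⁺ˡ a∈ys₁
    ... | inj₂ (here refl)    = contradiction refl x≢a
    ... | inj₂ (there a∈ys₂) = ∈-++⁺ʳ ys₁ a∈ys₂

  module _ {p} {P : Pred A p} (P? : Decidable P) where

    length-filter+∁ : ∀ xs → length (filter P? xs) + length (filter (∁? P?) xs) ≡ length xs
    length-filter+∁ [] = refl
    length-filter+∁ (x ∷ xs) with P? x
    ... | yes _ = cong suc (length-filter+∁ xs)
    ... | no  _ = trans (+-suc _ _) (cong suc (length-filter+∁ xs))

module _ {A B : Set} where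

  length-≤-injection : ∀ {f : A → B} {xs ys} → Injective _≡_ _≡_ f → Unique xs →
                       (∀ {a} → a ∈ xs → f a ∈ ys) → length xs ≤ length ys
  length-≤-injection {f} {xs} f-inj u maps = subst (_≤ _) (length-map f xs)
    (Unique-⊆⇒length-≤ (Unique.map⁺ f-inj u) λ b∈ →
      case ∈-map⁻ f b∈ of λ { (a , a∈ , refl) → maps a∈ })

  length-≤-fibres : (_≟_ : DecidableEquality B) (f : A → B) {c : ℕ} {xs : List A} (ys : List B) →
                    (∀ {a} → a ∈ xs → f a ∈ ys) →
                    (∀ {a} → a ∈ xs → length (filter (λ a′ → f a′ ≟ f a) xs) ≤ c) →
                    length xs ≤ length ys * c
  length-≤-fibres _≟_ f {xs = []}    []       maps fibre = z≤n
  length-≤-fibres _≟_ f {xs = a ∷ _} []       maps fibre with () ← maps (here refl)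
  length-≤-fibres _≟_ f {c} {xs} (y ∷ ys) maps fibre = begin
    length xs                                        ≡⟨ length-filter+∁ (λ a → f a ≟ y) xs ⟨
    length (filter (λ a → f a ≟ y) xs) + length rest ≤⟨ +-mono-≤ (fibre-y y) rest-bound ⟩
    c + length ys * c                                ∎
    where
    open ≤-Reasoning
    fibre-y : ∀ b → length (filter (λ a → f a ≟ b) xs) ≤ c
    fibre-y b with filter (λ a → f a ≟ b) xs in eq
    ... | []    = z≤n
    ... | a ∷ _ with ∈-filter⁻ (λ a → f a ≟ b) (subst (a ∈_) (sym eq) (here refl))
    ...   | a∈xs , refl = subst (λ as → length as ≤ c) eq (fibre a∈xs)
    rest = filter (∁? (λ a → f a ≟ y)) xs
    rest-maps : ∀ {a} → a ∈ rest → f a ∈ ys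
    rest-maps a∈ with ∈-filter⁻ (∁? (λ a → f a ≟ y)) a∈
    ... | a∈xs , fa≢y with maps a∈xs
    ...   | here fa≡y  = contradiction fa≡y fa≢y
    ...   | there fa∈ = fa∈
    rest-bound : length rest ≤ length ys * c
    rest-bound = length-≤-fibres _≟_ f ys rest-maps λ {a} a∈ →
      ≤-trans (length-mono-≤ (filter⁺ (λ a′ → f a′ ≟ f a) (λ a′ → f a′ ≟ f a) (λ { refl p → p })
                                      (filter-⊆ (∁? (λ a → f a ≟ y)) xs)))
              (fibre (proj₁ (∈-filter⁻ (∁? (λ a → f a ≟ y)) a∈)))

Unique-Fin⇒length-≤ : ∀ {n} {xs : List (Fin n)} → Unique xs → length xs ≤ n
Unique-Fin⇒length-≤ {n} {xs} u =
  subst (length xs ≤_) (length-tabulate id) (Unique-⊆⇒length-≤ u (λ {z} _ → ∈-allFin z))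

Unique-Fin-∉⇒length-< : ∀ {n} {xs : List (Fin n)} {z} → z ∉ xs → Unique xs → length xs < n
Unique-Fin-∉⇒length-< z∉xs u =
  Unique-Fin⇒length-≤ (All.tabulate (λ x∈xs z≡x → z∉xs (subst (_∈ _) (sym z≡x) x∈xs)) ∷ u)

module _ (s : ℕ) .{{_ : NonZero s}} where

  square-≤-^-* : ∀ a b k m → a ≤ s ^ k * b → 2 * k ≤ m → a ^ 2 ≤ s ^ m * b ^ 2
  square-≤-^-* a b k m a≤ 2k≤m = begin
    a ^ 2                 ≤⟨ ^-monoˡ-≤ 2 a≤ ⟩
    (s ^ k * b) ^ 2       ≡⟨ square-* (s ^ k) b ⟩
    (s ^ k) ^ 2 * b ^ 2   ≡⟨ cong (_* b ^ 2) (^-*-assoc s k 2) ⟩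
    s ^ (k * 2) * b ^ 2   ≤⟨ *-monoˡ-≤ (b ^ 2) (^-monoʳ-≤ s (subst (_≤ m) (*-comm 2 k) 2k≤m)) ⟩
    s ^ m * b ^ 2         ∎
    where
    open ≤-Reasoning
    open +-*-Solver
    square-* : ∀ x y → (x * y) ^ 2 ≡ x ^ 2 * y ^ 2
    square-* = solve 2 (λ x y → (x :* y) :^ 2 := x :^ 2 :* y :^ 2) refl

  *-^-shift : ∀ a b m l {N} → a ≤ s ^ m * b → b * s ^ (m + l) ≤ N → a * s ^ l ≤ N
  *-^-shift a b m l {N} a≤ b≤ = begin
    a * s ^ l               ≤⟨ *-monoˡ-≤ (s ^ l) a≤ ⟩
    s ^ m * b * s ^ l       ≡⟨ rearrange (s ^ m) b (s ^ l) ⟩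
    b * (s ^ m * s ^ l)     ≡⟨ cong (b *_) (^-distribˡ-+-* s m l) ⟨
    b * s ^ (m + l)         ≤⟨ b≤ ⟩
    N                       ∎
    where
    open ≤-Reasoning
    open +-*-Solver
    rearrange : ∀ x y z → x * y * z ≡ y * (x * z)
    rearrange = solve 3 (λ x y z → x :* y :* z := y :* (x :* z)) refl

  square-*-^-≤-of-≤1 : ∀ {a l n} → a ≤ 1 → l ≤ n → a ^ 2 * s ^ l ≤ s ^ n
  square-*-^-≤-of-≤1 {a} {l} {n} a≤1 l≤n = begin
    a ^ 2 * s ^ l   ≤⟨ *-monoˡ-≤ (s ^ l) (^-monoˡ-≤ 2 a≤1) ⟩
    1 * s ^ l       ≡⟨ *-identityˡ (s ^ l) ⟩
    s ^ l           ≤⟨ ^-monoʳ-≤ s l≤n ⟩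
    s ^ n           ∎
    where open ≤-Reasoning

  *-^-cancel : ∀ a m n → a * s ^ m ≤ s ^ n → m ≤ n → a ≤ s ^ (n ∸ m)
  *-^-cancel a m n a≤ m≤n = *-cancelʳ-≤ a (s ^ (n ∸ m)) (s ^ m) {{m^n≢0 s m}} (begin
    a * s ^ m                 ≤⟨ a≤ ⟩
    s ^ n                     ≡⟨ cong (s ^_) (m+[n∸m]≡n m≤n) ⟨
    s ^ (m + (n ∸ m))         ≡⟨ ^-distribˡ-+-* s m (n ∸ m) ⟩
    s ^ m * s ^ (n ∸ m)       ≡⟨ *-comm (s ^ m) _ ⟩
    s ^ (n ∸ m) * s ^ m       ∎)
    where open ≤-Reasoning

≤-suc-+-shift : ∀ {n k l m} → n ≤ suc k + l → 1 ≤ m → n ≤ k + (m + l)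
≤-suc-+-shift {n} {k} {l} {m} n≤ 1≤m = begin
  n              ≤⟨ n≤ ⟩
  suc k + l      ≡⟨ +-suc k l ⟨
  k + (1 + l)    ≤⟨ +-monoʳ-≤ k (+-monoˡ-≤ l 1≤m) ⟩
  k + (m + l)    ∎
  where open ≤-Reasoning

square-≤-^-∸⇒≤-^ : ∀ a s n → a ^ 2 ≤ s ^ (n ∸ 2) → a * 1 ^ n ≤ (2 + s) ^ n
square-≤-^-∸⇒≤-^ a s n a²≤ = begin
  a * 1 ^ n          ≡⟨ cong (a *_) (^-zeroˡ n) ⟩
  a * 1              ≡⟨ *-identityʳ a ⟩
  a                  ≤⟨ m≤m^2 a ⟩
  a ^ 2              ≤⟨ a²≤ ⟩
  s ^ (n ∸ 2)        ≤⟨ ^-monoˡ-≤ (n ∸ 2) (m≤n+m s 2) ⟩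
  (2 + s) ^ (n ∸ 2)  ≤⟨ ^-monoʳ-≤ (2 + s) (m∸n≤m n 2) ⟩
  (2 + s) ^ n        ∎
  where
  open ≤-Reasoning
  m≤m^2 : ∀ m → m ≤ m ^ 2
  m≤m^2 zero    = z≤n
  m≤m^2 (suc m) = m≤m*n (suc m) (suc m * 1)

module _ {n : ℕ} where

  ·-∘ₚ : ∀ (g h : Perm n) i → (g ∘ₚ h) · i ≡ g · (h · i)
  ·-∘ₚ g h = lookup∘tabulate _

  idPerm-· : ∀ (i : Fin n) → idPerm {n} · i ≡ i
  idPerm-· = lookup∘tabulate _

  Perm-ext : ∀ {g h : Perm n} → (∀ i → g · i ≡ h · i) → g ≡ h
  Perm-ext {g} {h} g≗h = begin
    g                  ≡⟨ tabulate∘lookup g ⟨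
    tabulate (g ·_)    ≡⟨ tabulate-cong g≗h ⟩
    tabulate (h ·_)    ≡⟨ tabulate∘lookup h ⟩
    h                  ∎
    where open ≡-Reasoning

module _ {n : ℕ} (G : PermGroup n) where

  inverse : ∀ {g} → g ∈ elems G →
            ∃[ h ] h ∈ elems G × (∀ z → g · (h · z) ≡ z) × (∀ z → h · (g · z) ≡ z)
  inverse {g} g∈G with closed-inv G g∈G
  ... | h , h∈G , gh≡id = h , h∈G , g·h· , λ z → bijective G g∈G (g·h· (g · z))
    where
    g·h· : ∀ z → g · (h · z) ≡ z
    g·h· z = trans (sym (·-∘ₚ g h z)) (trans (cong (_· z) gh≡id) (idPerm-· z))

  ∘ₚ-cancelˡ : ∀ {h} → h ∈ elems G → Injective _≡_ _≡_ (h ∘ₚ_)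
  ∘ₚ-cancelˡ {h} h∈G {a} {b} e = Perm-ext λ i →
    bijective G h∈G (trans (sym (·-∘ₚ h a i)) (trans (cong (_· i) e) (·-∘ₚ h b i)))

  ∘ₚ-cancelʳ : ∀ {t} → t ∈ elems G → Injective _≡_ _≡_ (_∘ₚ t)
  ∘ₚ-cancelʳ {t} t∈G {a} {b} e with inverse t∈G
  ... | t⁻¹ , _ , t·t⁻¹· , _ = Perm-ext λ i → begin
    a · i                  ≡⟨ cong (a ·_) (t·t⁻¹· i) ⟨
    a · (t · (t⁻¹ · i))    ≡⟨ ·-∘ₚ a t _ ⟨
    (a ∘ₚ t) · (t⁻¹ · i)   ≡⟨ cong (_· (t⁻¹ · i)) e ⟩
    (b ∘ₚ t) · (t⁻¹ · i)   ≡⟨ ·-∘ₚ b t _ ⟩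
    b · (t · (t⁻¹ · i))    ≡⟨ cong (b ·_) (t·t⁻¹· i) ⟩
    b · i                  ∎
    where open ≡-Reasoning

  stabiliser : List (Fin n) → List (Perm n)
  stabiliser S = filter (λ g → All.all? (λ z → g · z ≟ z) S) (elems G)

  ∈-stabiliser⁺ : ∀ {S g} → g ∈ elems G → (∀ {z} → z ∈ S → g · z ≡ z) → g ∈ stabiliser S
  ∈-stabiliser⁺ g∈G fixes = ∈-filter⁺ _ g∈G (All.tabulate fixes)

  ∈-stabiliser⁻ : ∀ {S g} → g ∈ stabiliser S → g ∈ elems G × (∀ {z} → z ∈ S → g · z ≡ z)
  ∈-stabiliser⁻ g∈ with ∈-filter⁻ _ g∈
  ... | g∈G , fixes = g∈G , All.lookup fixes

  stabiliser-unique : ∀ S → Unique (stabiliser S)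
  stabiliser-unique S = Unique.filter⁺ _ (unique G)

  idPerm∈stabiliser : ∀ S → idPerm ∈ stabiliser S
  idPerm∈stabiliser S = ∈-stabiliser⁺ (has-id G) λ {z} _ → idPerm-· z

  stabiliser-antitone : ∀ {S T} → (∀ {z} → z ∈ S → z ∈ T) →
                        length (stabiliser T) ≤ length (stabiliser S)
  stabiliser-antitone S⊆T = length-≤-injection (λ e → e) (stabiliser-unique _) λ g∈ →
    let g∈G , fixes = ∈-stabiliser⁻ g∈ in ∈-stabiliser⁺ g∈G (λ z∈S → fixes (S⊆T z∈S))

  stabOrder≡ : ∀ ω → stabOrder G ω ≡ length (stabiliser (ω ∷ []))
  stabOrder≡ ω = cong length (filter-≐ _ _ ((λ {g} → to {g}) , (λ {g} → from {g})) (elems G))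
    where
    to : ∀ {g} → T ⌊ g · ω ≟ ω ⌋ → All (λ z → g · z ≡ z) (ω ∷ [])
    to t = toWitness t ∷ []
    from : ∀ {g} → All (λ z → g · z ≡ z) (ω ∷ []) → T ⌊ g · ω ≟ ω ⌋
    from (e ∷ []) = fromWitness e

  stabOrder₂≡ : ∀ u v → stabOrder₂ G u v ≡ length (stabiliser (u ∷ v ∷ []))
  stabOrder₂≡ u v = cong length (filter-≐ _ _ ((λ {g} → to {g}) , (λ {g} → from {g})) (elems G))
    where
    to : ∀ {g} → T (⌊ g · u ≟ u ⌋ ∧ ⌊ g · v ≟ v ⌋) → All (λ z → g · z ≡ z) (u ∷ v ∷ [])
    to {g} t = let tu , tv = Equivalence.to (T-∧ {⌊ g · u ≟ u ⌋}) t
               in toWitness tu ∷ toWitness tv ∷ []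
    from : ∀ {g} → All (λ z → g · z ≡ z) (u ∷ v ∷ []) → T (⌊ g · u ≟ u ⌋ ∧ ⌊ g · v ≟ v ⌋)
    from {g} (eu ∷ ev ∷ []) =
      Equivalence.from (T-∧ {⌊ g · u ≟ u ⌋}) (fromWitness eu , fromWitness ev)

stabiliser-transitive-≤ : ∀ {d} (L : PermGroup d) → IsTransitive L → ∀ ω j →
                          length (stabiliser L (j ∷ [])) ≤ length (stabiliser L (ω ∷ []))
stabiliser-transitive-≤ L L-trans ω j with L-trans ω j
... | t , t∈L , t·ω≡j with inverse L t∈L
...   | t⁻¹ , t⁻¹∈L , _ , t⁻¹·t· =
  length-≤-injection (λ {a} {b} e → ∘ₚ-cancelʳ L t∈L (∘ₚ-cancelˡ L t⁻¹∈L {a ∘ₚ t} {b ∘ₚ t} e))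
                     (stabiliser-unique L _) conjugate∈
  where
  conjugate∈ : ∀ {l} → l ∈ stabiliser L (j ∷ []) → t⁻¹ ∘ₚ (l ∘ₚ t) ∈ stabiliser L (ω ∷ [])
  conjugate∈ {l} l∈ with ∈-stabiliser⁻ L l∈
  ... | l∈L , l-fixes = ∈-stabiliser⁺ L (closed-∘ L t⁻¹∈L (closed-∘ L l∈L t∈L))
    λ { (here refl) → begin
      (t⁻¹ ∘ₚ (l ∘ₚ t)) · ω    ≡⟨ ·-∘ₚ t⁻¹ (l ∘ₚ t) ω ⟩
      t⁻¹ · ((l ∘ₚ t) · ω)     ≡⟨ cong (t⁻¹ ·_) (·-∘ₚ l t ω) ⟩
      t⁻¹ · (l · (t · ω))      ≡⟨ cong (λ z → t⁻¹ · (l · z)) t·ω≡j ⟩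
      t⁻¹ · (l · j)            ≡⟨ cong (t⁻¹ ·_) (l-fixes (here refl)) ⟩
      t⁻¹ · j                  ≡⟨ cong (t⁻¹ ·_) t·ω≡j ⟨
      t⁻¹ · (t · ω)            ≡⟨ t⁻¹·t· ω ⟩
      ω                        ∎ }
    where open ≡-Reasoning

exit-edge : ∀ {n} {adj : Fin n → Fin n → Bool} {p} {P : Pred (Fin n) p} → Decidable P →
            ∀ {a z} → Reachable adj a z → P a → ¬ P z →
            ∃[ x ] ∃[ w ] P x × ¬ P w × adj x w ≡ true
exit-edge P? here                   Pa ¬Pz = contradiction Pa ¬Pz
exit-edge P? (step {w = w} a~w w⇝z) Pa ¬Pz with P? w
... | yes Pw  = exit-edge P? w⇝z Pw ¬Pz
... | no  ¬Pw = _ , w , Pa , ¬Pw , a~w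

module LocallyL {n d} (L : PermGroup d) (L-transitive : IsTransitive L) (ω : Fin d)
                (Γ : Graph n) (G : PermGroup n) (locally : IsLocally Γ G L) where

  open DecMembership (_≟_ {n}) using (_∈?_)

  s : ℕ
  s = stabOrder L ω

  instance
    s-nonZero : NonZero s
    s-nonZero = >-nonZero (subst (0 <_) (sym (stabOrder≡ L ω)) (∈-length (idPerm∈stabiliser L _)))

  automorphism : IsAutGroup Γ G
  automorphism = proj₁ locally

  private
    iso : ∀ x → LocalActionIso Γ G x L
    iso x = proj₂ (proj₂ locally) x

  neighbour : Fin n → Fin d → Fin n
  neighbour x = proj₁ (iso x)

  neighbour-injective : ∀ x → Injective _≡_ _≡_ (neighbour x)
  neighbour-injective x with iso x
  ... | _ , injective , _ = injective

  neighbour-adjacent : ∀ x i → adj Γ x (neighbour x i) ≡ true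
  neighbour-adjacent x with iso x
  ... | _ , _ , adjacent , _ = adjacent

  neighbour-surjective : ∀ x {w} → adj Γ x w ≡ true → ∃[ i ] neighbour x i ≡ w
  neighbour-surjective x with iso x
  ... | _ , _ , _ , surjective , _ = surjective _

  local-action : ∀ x {g} → g ∈ elems G → g · x ≡ x →
                 ∃[ l ] l ∈ elems L × (∀ i → g · neighbour x i ≡ neighbour x (l · i))
  local-action x with iso x
  ... | _ , _ , _ , _ , induced , _ = induced

  Γ[_] : Fin n → List (Fin n)
  Γ[ x ] = List.tabulate (neighbour x)

  ∈-Γ⁻ : ∀ {x z} → z ∈ Γ[ x ] → adj Γ x z ≡ true
  ∈-Γ⁻ {x} z∈ with ∈-tabulate⁻ z∈
  ... | i , refl = neighbour-adjacent x i

  ∈-Γ⁺ : ∀ {x z} → adj Γ x z ≡ true → z ∈ Γ[ x ]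
  ∈-Γ⁺ {x} x~z with neighbour-surjective x x~z
  ... | i , refl = ∈-tabulate⁺ i

  fixes-adjacent : ∀ {g x z} → g ∈ elems G → g · x ≡ x → adj Γ x z ≡ true → adj Γ x (g · z) ≡ true
  fixes-adjacent {g} {x} {z} g∈G gx≡x x~z = begin
    adj Γ x (g · z)        ≡⟨ cong (λ v → adj Γ v (g · z)) gx≡x ⟨
    adj Γ (g · x) (g · z)  ≡⟨ automorphism g∈G x z ⟩
    adj Γ x z              ≡⟨ x~z ⟩
    true                   ∎
    where open ≡-Reasoning

  restriction : Fin n → Perm n → Vec (Fin n) d
  restriction x g = tabulate (λ i → g · neighbour x i)

  restriction≡⇒agree : ∀ {x g h} → restriction x g ≡ restriction x h →
                       ∀ {z} → z ∈ Γ[ x ] → g · z ≡ h · z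
  restriction≡⇒agree {x} {g} {h} e z∈ with ∈-tabulate⁻ z∈
  ... | i , refl = begin
    g · neighbour x i               ≡⟨ lookup∘tabulate _ i ⟨
    lookup (restriction x g) i      ≡⟨ cong (λ r → lookup r i) e ⟩
    lookup (restriction x h) i      ≡⟨ lookup∘tabulate _ i ⟩
    h · neighbour x i               ∎
    where open ≡-Reasoning

  stabiliser-≤-* : ∀ {S x y} → x ∈ S → y ∈ S → adj Γ x y ≡ true →
                   length (stabiliser G S) ≤ s * length (stabiliser G (Γ[ x ] ++ S))
  stabiliser-≤-* {S} {x} {y} x∈S y∈S x~y with neighbour-surjective x x~y
  ... | j , refl = ≤-trans
    (length-≤-fibres (≡-dec _≟_) (restriction x) restrictions restriction∈ fibre-bound)
    (*-monoˡ-≤ _ restrictions-bound)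
    where
    induced : Perm d → Vec (Fin n) d
    induced l = tabulate (λ i → neighbour x (l · i))
    restrictions : List (Vec (Fin n) d)
    restrictions = map induced (stabiliser L (j ∷ []))
    restrictions-bound : length restrictions ≤ s
    restrictions-bound = begin
      length restrictions                  ≡⟨ length-map induced (stabiliser L (j ∷ [])) ⟩
      length (stabiliser L (j ∷ []))       ≤⟨ stabiliser-transitive-≤ L L-transitive ω j ⟩
      length (stabiliser L (ω ∷ []))       ≡⟨ stabOrder≡ L ω ⟨
      s                                    ∎
      where open ≤-Reasoning
    restriction∈ : ∀ {g} → g ∈ stabiliser G S → restriction x g ∈ restrictions
    restriction∈ {g} g∈ with ∈-stabiliser⁻ G g∈
    ... | g∈G , g-fixes with local-action x g∈G (g-fixes x∈S)
    ...   | l , l∈L , g-acts-as-l =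
      subst (_∈ restrictions) (tabulate-cong (λ i → sym (g-acts-as-l i)))
            (∈-map⁺ induced (∈-stabiliser⁺ L l∈L λ { (here refl) → l-fixes-j }))
      where
      l-fixes-j : l · j ≡ j
      l-fixes-j = neighbour-injective x (trans (sym (g-acts-as-l j)) (g-fixes y∈S))
    fibre-bound : ∀ {g₀} → g₀ ∈ stabiliser G S →
                  length (filter (λ g → ≡-dec _≟_ (restriction x g) (restriction x g₀))
                                 (stabiliser G S))
                  ≤ length (stabiliser G (Γ[ x ] ++ S))
    fibre-bound {g₀} g₀∈ with ∈-stabiliser⁻ G g₀∈
    ... | g₀∈G , g₀-fixes with inverse G g₀∈G
    ...   | g₀⁻¹ , g₀⁻¹∈G , _ , g₀⁻¹·g₀· =
      length-≤-injection (∘ₚ-cancelˡ G g₀⁻¹∈G) (Unique.filter⁺ _ (stabiliser-unique G S)) translate∈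
      where
      translate∈ : ∀ {g} → g ∈ filter _ (stabiliser G S) → g₀⁻¹ ∘ₚ g ∈ stabiliser G (Γ[ x ] ++ S)
      translate∈ {g} g∈ with ∈-filter⁻ _ g∈
      ... | g∈stab , same-restriction with ∈-stabiliser⁻ G g∈stab
      ...   | g∈G , g-fixes = ∈-stabiliser⁺ G (closed-∘ G g₀⁻¹∈G g∈G) λ {z} z∈ →
        trans (·-∘ₚ g₀⁻¹ g z) (trans (cong (g₀⁻¹ ·_) (agree z∈)) (g₀⁻¹·g₀· z))
        where
        agree : ∀ {z} → z ∈ Γ[ x ] ++ S → g · z ≡ g₀ · z
        agree z∈ with ∈-++⁻ Γ[ x ] z∈
        ... | inj₁ z∈Γ = restriction≡⇒agree {x} {g} {g₀} same-restriction z∈Γ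
        ... | inj₂ z∈S = trans (g-fixes z∈S) (sym (g₀-fixes z∈S))

  newNeighbours : Fin n → List (Fin n) → List (Fin n)
  newNeighbours x S = filter (λ z → ¬? (z ∈? S)) Γ[ x ]

  ∈-newNeighbours⁺ : ∀ {x S z} → adj Γ x z ≡ true → z ∉ S → z ∈ newNeighbours x S
  ∈-newNeighbours⁺ x~z z∉S = ∈-filter⁺ _ (∈-Γ⁺ x~z) z∉S

  ∈-newNeighbours⁻ : ∀ {x S z} → z ∈ newNeighbours x S → z ∈ Γ[ x ] × z ∉ S
  ∈-newNeighbours⁻ = ∈-filter⁻ _

  newNeighbours-unique : ∀ x S → Unique (newNeighbours x S)
  newNeighbours-unique x S = Unique.filter⁺ _ (Unique.tabulate⁺ (neighbour-injective x))

  fixes-sole-new-neighbour : ∀ {S x w g} → x ∈ S → newNeighbours x S ≡ w ∷ [] →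
                             g ∈ stabiliser G S → g · w ≡ w
  fixes-sole-new-neighbour {S} {x} {w} {g} x∈S sole g∈ with ∈-stabiliser⁻ G g∈
  ... | g∈G , g-fixes with (g · w) ∈? S
  ...   | yes gw∈S = bijective G g∈G (g-fixes gw∈S)
  ...   | no  gw∉S with subst (g · w ∈_) sole (∈-newNeighbours⁺ x~gw gw∉S)
    where
    x~gw : adj Γ x (g · w) ≡ true
    x~gw = fixes-adjacent g∈G (g-fixes x∈S)
             (∈-Γ⁻ (proj₁ (∈-newNeighbours⁻ (subst (w ∈_) (sym sole) (here refl)))))
  ...     | here gw≡w = gw≡w

  -- A single new neighbour is already fixed by G_S and costs nothing; two or more cost one
  -- factor s. So every new vertex costs at most a factor √s.
  stabiliser-square-≤ : ∀ {S x y} → x ∈ S → y ∈ S → adj Γ x y ≡ true →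
                        ∀ ns → newNeighbours x S ≡ ns →
                        length (stabiliser G S) ^ 2
                          ≤ s ^ length ns * length (stabiliser G (ns ++ S)) ^ 2
  stabiliser-square-≤ {S} _ _ _ [] _ =
    square-≤-^-* s _ _ 0 0 (≤-reflexive (sym (*-identityˡ (length (stabiliser G S))))) z≤n
  stabiliser-square-≤ {S} x∈S _ _ (w ∷ []) sole = square-≤-^-* s _ _ 0 1 stab-≤ z≤n
    where
    stab-≤ : length (stabiliser G S) ≤ 1 * length (stabiliser G (w ∷ S))
    stab-≤ = subst (_ ≤_) (sym (*-identityˡ _))
      (length-≤-injection (λ e → e) (stabiliser-unique G S) λ g∈ →
        let g∈G , g-fixes = ∈-stabiliser⁻ G g∈ in
        ∈-stabiliser⁺ G g∈G λ { (here refl) → fixes-sole-new-neighbour x∈S sole g∈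
                              ; (there z∈S) → g-fixes z∈S })
  stabiliser-square-≤ {S} {x} x∈S y∈S x~y ns@(_ ∷ _ ∷ _) new≡ns =
    square-≤-^-* s _ _ 1 (length ns) stab-≤ (s≤s (s≤s z≤n))
    where
    stab-≤ : length (stabiliser G S) ≤ s ^ 1 * length (stabiliser G (ns ++ S))
    stab-≤ = begin
      length (stabiliser G S)                   ≤⟨ stabiliser-≤-* x∈S y∈S x~y ⟩
      s * length (stabiliser G (Γ[ x ] ++ S))   ≤⟨ *-monoʳ-≤ s (stabiliser-antitone G ns⊆) ⟩
      s * length (stabiliser G (ns ++ S))       ≡⟨ cong (_* _) (^-identityʳ s) ⟨
      s ^ 1 * length (stabiliser G (ns ++ S))   ∎
      where
      open ≤-Reasoning
      ns⊆ : ∀ {z} → z ∈ ns ++ S → z ∈ Γ[ x ] ++ S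
      ns⊆ z∈ with ∈-++⁻ ns z∈
      ... | inj₁ z∈ns = ∈-++⁺ˡ (proj₁ (∈-newNeighbours⁻ (subst (_ ∈_) (sym new≡ns) z∈ns)))
      ... | inj₂ z∈S  = ∈-++⁺ʳ Γ[ x ] z∈S

  NoIsolatedVertex : List (Fin n) → Set
  NoIsolatedVertex S = ∀ {x} → x ∈ S → ∃[ y ] y ∈ S × adj Γ x y ≡ true

  extend-NoIsolatedVertex : ∀ {S x} → x ∈ S → NoIsolatedVertex S →
                            NoIsolatedVertex (newNeighbours x S ++ S)
  extend-NoIsolatedVertex {S} {x} x∈S no-isolated z∈ with ∈-++⁻ (newNeighbours x S) z∈
  ... | inj₁ z∈new = x , ∈-++⁺ʳ _ x∈S ,
                     trans (adj-sym Γ _ x) (∈-Γ⁻ (proj₁ (∈-newNeighbours⁻ z∈new)))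
  ... | inj₂ z∈S with no-isolated z∈S
  ...   | y , y∈S , z~y = y , ∈-++⁺ʳ _ y∈S , z~y

  extend-unique : ∀ {S} x → Unique S → Unique (newNeighbours x S ++ S)
  extend-unique {S} x S-unique = Unique.++⁺ (newNeighbours-unique x S) S-unique
    λ (z∈new , z∈S) → proj₂ (∈-newNeighbours⁻ z∈new) z∈S

  stabiliser-covering : ∀ {S} → (∀ z → z ∈ S) → length (stabiliser G S) ≤ 1
  stabiliser-covering {S} covers =
    Unique-⊆⇒length-≤ {ys = idPerm ∷ []} (stabiliser-unique G S) λ g∈ → here (Perm-ext {h = idPerm} λ i →
      trans (proj₂ (∈-stabiliser⁻ G g∈) (covers i)) (sym (idPerm-· i)))

  frontier-edge : ∀ {u S} → u ∈ S → ¬ (∀ z → z ∈ S) →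
                  ∃[ x ] ∃[ w ] x ∈ S × w ∉ S × adj Γ x w ≡ true
  frontier-edge {u} {S} u∈S ¬covers with ¬∀⟶∃¬ n _ (_∈? S) ¬covers
  ... | z , z∉S = exit-edge (_∈? S) (connected Γ u z) u∈S z∉S

  -- k is fuel: n ≤ k + |S|, and each extension adds at least one vertex.
  stabiliser-bound : ∀ {u} k {S} → Unique S → u ∈ S → NoIsolatedVertex S → n ≤ k + length S →
                     length (stabiliser G S) ^ 2 * s ^ length S ≤ s ^ n
  stabiliser-bound {u} k {S} S-unique u∈S no-isolated n≤ with all? (_∈? S)
  ... | yes covers =
    square-*-^-≤-of-≤1 s (stabiliser-covering covers) (Unique-Fin⇒length-≤ S-unique)
  ... | no ¬covers with frontier-edge u∈S ¬covers
  ...   | x , w , x∈S , w∉S , x~w with k | no-isolated x∈S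
  ...     | zero  | _ = contradiction n≤ (<⇒≱ (Unique-Fin-∉⇒length-< w∉S S-unique))
  ...     | suc k | y , y∈S , x~y = *-^-shift s _ _ (length new) (length S) extension-step ih
    where
    new = newNeighbours x S
    S′ = new ++ S
    extension-step : length (stabiliser G S) ^ 2 ≤ s ^ length new * length (stabiliser G S′) ^ 2
    extension-step = stabiliser-square-≤ x∈S y∈S x~y new refl
    n≤′ : n ≤ k + length S′
    n≤′ = subst (n ≤_) (cong (k +_) (sym (length-++ new)))
            (≤-suc-+-shift {k = k} n≤ (∈-length (∈-newNeighbours⁺ x~w w∉S)))
    ih : length (stabiliser G S′) ^ 2 * s ^ (length new + length S) ≤ s ^ n
    ih = subst (λ l → length (stabiliser G S′) ^ 2 * s ^ l ≤ s ^ n) (length-++ new)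
           (stabiliser-bound k (extend-unique x S-unique) (∈-++⁺ʳ new u∈S)
                             (extend-NoIsolatedVertex x∈S no-isolated) n≤′)

  arc-stabiliser-bound : ∀ {u v} → adj Γ u v ≡ true → stabOrder₂ G u v ^ 2 ≤ s ^ (n ∸ 2)
  arc-stabiliser-bound {u} {v} u~v = *-^-cancel s (stabOrder₂ G u v ^ 2) 2 n
    (subst (λ a → a ^ 2 * s ^ 2 ≤ s ^ n) (sym (stabOrder₂≡ G u v))
      (stabiliser-bound n arc-unique (here refl) arc-no-isolated (m≤m+n n 2)))
    (Unique-Fin⇒length-≤ arc-unique)
    where
    u≢v : u ≢ v
    u≢v refl with () ← trans (sym u~v) (irrefl Γ u)
    arc-unique : Unique (u ∷ v ∷ [])
    arc-unique = (u≢v ∷ []) ∷ [] ∷ []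
    arc-no-isolated : NoIsolatedVertex (u ∷ v ∷ [])
    arc-no-isolated (here refl)         = v , there (here refl) , u~v
    arc-no-isolated (there (here refl)) = u , here refl , trans (adj-sym Γ v u) u~v

theorem2p1 : ∀ {d} (L : PermGroup d) → IsTransitive L → (ω : Fin d) →
    GraphRestrictive L (λ n s → s ^ 2 ≤ stabOrder L ω ^ (n ∸ 2))
    × Σ ℕ (λ p → Σ ℕ λ q → 0 < q × q < p ×
    GraphRestrictive L (λ n s → s * q ^ n ≤ p ^ n))
theorem2p1 L L-transitive ω =
  arc-bound ,
  2 + stabOrder L ω , 1 , s≤s z≤n , s≤s (s≤s z≤n) ,
  λ n Γ G locally u v u~v →
    square-≤-^-∸⇒≤-^ (stabOrder₂ G u v) (stabOrder L ω) n (arc-bound n Γ G locally u v u~v)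
  where
  arc-bound : GraphRestrictive L (λ n s → s ^ 2 ≤ stabOrder L ω ^ (n ∸ 2))
  arc-bound n Γ G locally u v u~v =
    LocallyL.arc-stabiliser-bound L L-transitive ω Γ G locally u~v
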